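{- Over the class $\mathsf{Lin}$ of all linear orders, each of the following sets $S$ is $\mathrm{ii}_{04}$-complete (i.e., $FO+S$ defines $\mathrm{ii}_{04}$): $\{\mathrm{ip}_0,\mathrm{ii}_{24},\mathrm{ii}_{44}\}$, $\{\mathrm{ip}_4,\mathrm{ii}_{24},\mathrm{ii}_{44}\}$, $\{\mathrm{ip}_1,\mathrm{ii}_{24},\mathrm{ii}_{44}\}$, $\{\mathrm{ip}_3,\mathrm{ii}_{24},\mathrm{ii}_{44}\}$, $\{\mathrm{ip}_2,\mathrm{ii}_{24},\mathrm{ii}_{44}\}$, $\{\mathrm{ip}_0,\mathrm{ip}_2\}$, $\{\mathrm{ip}_0,\mathrm{ip}_3\}$, $\{\mathrm{ip}_0,\mathrm{ip}_4\}$, $\{\mathrm{ip}_0,\mathrm{ii}_{03}\}$, $\{\mathrm{ip}_1,\mathrm{ip}_2\}$, $\{\mathrm{ip}_1,\mathrm{ip}_3\}$, $\{\mathrm{ip}_1,\mathrm{ip}_4\}$, $\{\mathrm{ip}_1,\mathrm{ii}_{03}\}$, $\{\mathrm{ip}_2,\mathrm{ip}_3\}$, $\{\mathrm{ip}_2,\mathrm{ip}_4\}$, $\{\mathrm{ip}_2,\mathrm{ii}_{14}\}$, $\{\mathrm{ip}_2,\mathrm{ii}_{03}\}$, $\{\mathrm{ip}_2,\mathrm{ii}_{44},<\}$, $\{\mathrm{ip}_3,\mathrm{ii}_{14}\}$, $\{\mathrm{ip}_4,\mathrm{ii}_{14}\}$, $\{\mathrm{ii}_{14},\mathrm{ii}_{24}\}$,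 $\{\mathrm{ii}_{14},\mathrm{ii}_{03}\}$, $\{\mathrm{ii}_{14},\mathrm{ii}_{44}\}$, $\{\mathrm{ii}_{24},\mathrm{ii}_{03}\}$, $\{\mathrm{ii}_{03},\mathrm{ii}_{44}\}$, $\{\mathrm{ii}_{34}\}$.
   Context: Let $\mathbb D=(D,<)$ be a linear order; intervals are pairs $[a,b]$ of points with $a<b$, $\mathbb I(\mathbb D)$ the set of intervals. An interval $[a,b]$ partitions $D$ into regions $0=\{x<a\}$, $1=\{a\}$, $2=\{a<x<b\}$, $3=\{b\}$, $4=\{x>b\}$. Interval-point relations: $[a,b]\,\mathrm{ip}_k\,c$ iff $c$ lies in region $k$ ($k=0,\dots,4$). Interval-interval relations: $[a,b]\,\mathrm{ii}_{kk'}\,[c,d]$ iff $c$ lies in region $k$ and $d$ in region $k'$ of $[a,b]$; in particular $\mathrm{ii}_{34}$: $b=c$; $\mathrm{ii}_{44}$: $b<c$; $\mathrm{ii}_{14}$: $a=c,b<d$; $\mathrm{ii}_{03}$: $c<a,d=b$; $\mathrm{ii}_{04}$: $c<a,b<d$; $\mathrm{ii}_{24}$: $a<c<b<d$; $<$ is the order on points. For a set $S$ of relations, $FO+S$ is two-sorted first-order logic without equality (sorts: points and intervals) with only relation symbols for members of $S$, interpreted on $\langle D,\mathbb I(\mathbb D)\rangle$. $S$ is $r$-complete over a class $\mathrm C$ if some $FO+S$ formula $\varphi(x,y)$ with free variables exactly $x,y$ (of the sorts of $r$'s arguments) satisfies $\varphi(x,y)\leftrightarrow r(x,y)$ for all appropriate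 $x,y$ in every $\langle D,\mathbb I(\mathbb D)\rangle$ with $\mathbb D\in\mathrm C$. -}

module Defs where

open import Level using (0ℓ)
open import Data.Fin using (Fin)
open import Data.Fin.Patterns using (0F; 1F; 2F; 3F; 4F)
open import Data.List using (List; []; _∷_)
open import Data.List.Membership.Propositional using (_∈_)
open import Data.List.Relation.Unary.All using (All; lookup) renaming ([] to []ᵉ; _∷_ to _∷ᵉ_)
open import Data.Product using (Σ; _×_; ∃)
open import Data.Sum using (_⊎_)
open import Data.Empty using (⊥)
open import Function.Bundles using (_⇔_)
open import Relation.Binary.Core using (Rel)
open import Relation.Binary.Structures using (IsStrictTotalOrder)
open import Relation.Binary.PropositionalEquality using (_≡_)

record LinOrder : Set₁ where
  field
    Carrier : Set
    _<_     : Rel Carrier 0ℓ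
    isSTO   : IsStrictTotalOrder _≡_ _<_

record Interval (L : LinOrder) : Set where
  open LinOrder L
  field
    lo    : Carrier
    hi    : Carrier
    lo<hi : lo < hi

Region : (L : LinOrder) → Fin 5 → LinOrder.Carrier L → LinOrder.Carrier L → LinOrder.Carrier L → Set
Region L 0F a b x = LinOrder._<_ L x a
Region L 1F a b x = x ≡ a
Region L 2F a b x = LinOrder._<_ L a x × LinOrder._<_ L x b
Region L 3F a b x = x ≡ b
Region L 4F a b x = LinOrder._<_ L b x

data Sort : Set where
  pt int : Sort

⟦_⟧ˢ : Sort → LinOrder → Set
⟦ pt ⟧ˢ  L = LinOrder.Carrier L
⟦ int ⟧ˢ L = Interval L

data Sym : Set where
  ip : Fin 5 → Sym
  ii : Fin 5 → Fin 5 → Sym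
  lt : Sym

arg₁ arg₂ : Sym → Sort
arg₁ (ip _)   = int
arg₁ (ii _ _) = int
arg₁ lt       = pt
arg₂ (ip _)   = pt
arg₂ (ii _ _) = int
arg₂ lt       = pt

⟦_⟧ʳ : (r : Sym) (L : LinOrder) → ⟦ arg₁ r ⟧ˢ L → ⟦ arg₂ r ⟧ˢ L → Set
⟦ ip k ⟧ʳ    L I c = Region L k (Interval.lo I) (Interval.hi I) c
⟦ ii k k' ⟧ʳ L I J = Region L k  (Interval.lo I) (Interval.hi I) (Interval.lo J)
                   × Region L k' (Interval.lo I) (Interval.hi I) (Interval.hi J)
⟦ lt ⟧ʳ      L x y = LinOrder._<_ L x y

-- FO+S: two-sorted first-order logic without equality, whose only
-- relation symbols are those in S. Variables are typed de Bruijn indices.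

data Formula (S : List Sym) (Γ : List Sort) : Set where
  atom : (r : Sym) → r ∈ S → arg₁ r ∈ Γ → arg₂ r ∈ Γ → Formula S Γ
  ⊥̇    : Formula S Γ
  ¬̇_   : Formula S Γ → Formula S Γ
  _∧̇_  : Formula S Γ → Formula S Γ → Formula S Γ
  _∨̇_  : Formula S Γ → Formula S Γ → Formula S Γ
  _⇒̇_  : Formula S Γ → Formula S Γ → Formula S Γ
  ∀̇    : (s : Sort) → Formula S (s ∷ Γ) → Formula S Γ
  ∃̇    : (s : Sort) → Formula S (s ∷ Γ) → Formula S Γ

Env : LinOrder → List Sort → Set
Env L Γ = All (λ s → ⟦ s ⟧ˢ L) Γ

Sat : {S : List Sym} {Γ : List Sort} (L : LinOrder) → Formula S Γ → Env L Γ → Set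
Sat L (atom r _ x y) ρ = ⟦ r ⟧ʳ L (lookup ρ x) (lookup ρ y)
Sat L ⊥̇ ρ = ⊥
Sat L (¬̇ φ) ρ = Sat L φ ρ → ⊥
Sat L (φ ∧̇ ψ) ρ = Sat L φ ρ × Sat L ψ ρ
Sat L (φ ∨̇ ψ) ρ = Sat L φ ρ ⊎ Sat L ψ ρ
Sat L (φ ⇒̇ ψ) ρ = Sat L φ ρ → Sat L ψ ρ
Sat L (∀̇ s φ) ρ = (v : ⟦ s ⟧ˢ L) → Sat L φ (v ∷ᵉ ρ)
Sat L (∃̇ s φ) ρ = Σ (⟦ s ⟧ˢ L) (λ v → Sat L φ (v ∷ᵉ ρ))

-- S is r-complete over Lin: some FO+S formula φ(x,y) (x of sort arg₁ r,
-- y of sort arg₂ r; x is de Bruijn index 0, y index 1) defines r in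
-- every ⟨D, I(D)⟩ with D a linear order.

Complete : List Sym → Sym → Set₁
Complete S r =
  Σ (Formula S (arg₁ r ∷ arg₂ r ∷ [])) λ φ →
    (L : LinOrder) (x : ⟦ arg₁ r ⟧ˢ L) (y : ⟦ arg₂ r ⟧ˢ L) →
      Sat L φ (x ∷ᵉ y ∷ᵉ []ᵉ) ⇔ ⟦ r ⟧ʳ L x y

ip₀ ip₁ ip₂ ip₃ ip₄ : Sym
ip₀ = ip 0F
ip₁ = ip 1F
ip₂ = ip 2F
ip₃ = ip 3F
ip₄ = ip 4F

ii₃₄ ii₄₄ ii₁₄ ii₀₃ ii₀₄ ii₂₄ : Sym
ii₃₄ = ii 3F 4F
ii₄₄ = ii 4F 4F
ii₁₄ = ii 1F 4F
ii₀₃ = ii 0F 3F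
ii₀₄ = ii 0F 4F
ii₂₄ = ii 2F 4F

lemmaSets : List (List Sym)
lemmaSets =
    (ip₀ ∷ ii₂₄ ∷ ii₄₄ ∷ [])
  ∷ (ip₄ ∷ ii₂₄ ∷ ii₄₄ ∷ [])
  ∷ (ip₁ ∷ ii₂₄ ∷ ii₄₄ ∷ [])
  ∷ (ip₃ ∷ ii₂₄ ∷ ii₄₄ ∷ [])
  ∷ (ip₂ ∷ ii₂₄ ∷ ii₄₄ ∷ [])
  ∷ (ip₀ ∷ ip₂ ∷ [])
  ∷ (ip₀ ∷ ip₃ ∷ [])
  ∷ (ip₀ ∷ ip₄ ∷ [])
  ∷ (ip₀ ∷ ii₀₃ ∷ [])
  ∷ (ip₁ ∷ ip₂ ∷ [])
  ∷ (ip₁ ∷ ip₃ ∷ [])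
  ∷ (ip₁ ∷ ip₄ ∷ [])
  ∷ (ip₁ ∷ ii₀₃ ∷ [])
  ∷ (ip₂ ∷ ip₃ ∷ [])
  ∷ (ip₂ ∷ ip₄ ∷ [])
  ∷ (ip₂ ∷ ii₁₄ ∷ [])
  ∷ (ip₂ ∷ ii₀₃ ∷ [])
  ∷ (ip₂ ∷ ii₄₄ ∷ lt ∷ [])
  ∷ (ip₃ ∷ ii₁₄ ∷ [])
  ∷ (ip₄ ∷ ii₁₄ ∷ [])
  ∷ (ii₁₄ ∷ ii₂₄ ∷ [])
  ∷ (ii₁₄ ∷ ii₀₃ ∷ [])
  ∷ (ii₁₄ ∷ ii₄₄ ∷ [])
  ∷ (ii₂₄ ∷ ii₀₃ ∷ [])
  ∷ (ii₀₃ ∷ ii₄₄ ∷ [])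
  ∷ (ii₃₄ ∷ [])
  ∷ []

-- ii₀₄(I,J) says lo J < lo I and hi I < hi J. Most sets S express the two
-- comparisons separately, each by a formula that need only be sound for its
-- comparison and true on ii₀₄; the rest define ii₀₄ in one formula. Equality
-- and order of endpoints are recovered by quantifying over auxiliary points and
-- intervals: e.g. with ip₀, lo I < lo J iff some point lies below J but not
-- below I; with ii₄₄, two intervals end at the same point once they precede the
-- same intervals, tested on intervals built from the endpoints at hand.
module Submission where

open import Level using (0ℓ)
open import Data.Empty using (⊥-elim)
open import Data.List using (List; []; _∷_)
open import Data.List.Membership.Propositional using (_∈_)
open import Data.List.Relation.Unary.All using (All; lookup) renaming ([] to []ᵃ; _∷_ to _∷ᵃ_)
open import Data.List.Relation.Unary.Any using (here; there)
open import Data.Product using (_×_; _,_; proj₁; proj₂)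
open import Data.Sum using (_⊎_; inj₁; inj₂)
open import Function.Base using (_∘_)
open import Function.Bundles using (mk⇔)
open import Relation.Binary.Core using (Rel)
open import Relation.Binary.Definitions using (tri<; tri≈; tri>)
open import Relation.Binary.PropositionalEquality using (_≡_; refl; sym; trans; subst; subst₂)
open import Relation.Binary.Structures using (IsStrictTotalOrder)
open import Relation.Nullary using (¬_)
open import Defs

module LinOrderProperties (L : LinOrder) where
  open LinOrder L public
  open Interval public
  open IsStrictTotalOrder isSTO public using (compare) renaming (trans to <-trans; asym to <-asym)

  <-irrefl : ∀ {x} → ¬ x < x
  <-irrefl = IsStrictTotalOrder.irrefl isSTO refl

  _≤_ : Rel Carrier 0ℓ
  x ≤ y = ¬ y < x

  <-≤-trans : ∀ {x y z} → x < y → y ≤ z → x < z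
  <-≤-trans {x} {y} {z} x<y y≤z with compare x z
  ... | tri< x<z _ _ = x<z
  ... | tri≈ _ refl _ = ⊥-elim (y≤z x<y)
  ... | tri> _ _ z<x = ⊥-elim (y≤z (<-trans z<x x<y))

  ≤-<-trans : ∀ {x y z} → x ≤ y → y < z → x < z
  ≤-<-trans {x} {y} {z} x≤y y<z with compare x z
  ... | tri< x<z _ _ = x<z
  ... | tri≈ _ refl _ = ⊥-elim (x≤y y<z)
  ... | tri> _ _ z<x = ⊥-elim (x≤y (<-trans y<z z<x))

  ≤-antisym : ∀ {x y} → x ≤ y → y ≤ x → x ≡ y
  ≤-antisym {x} {y} x≤y y≤x with compare x y
  ... | tri< x<y _ _ = ⊥-elim (y≤x x<y)
  ... | tri≈ _ x≡y _ = x≡y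
  ... | tri> _ _ y<x = ⊥-elim (x≤y y<x)

  interval : ∀ {x y} → x < y → Interval L
  interval {x} {y} x<y = record { lo = x ; hi = y ; lo<hi = x<y }

private variable
  S : List Sym
  Γ : List Sort
  L : LinOrder
  I J : Interval L

v0 : ∀ {A : Set} {x : A} {xs} → x ∈ x ∷ xs
v0 = here refl
v1 : ∀ {A : Set} {x y : A} {xs} → x ∈ y ∷ x ∷ xs
v1 = there v0
v2 : ∀ {A : Set} {x y z : A} {xs} → x ∈ y ∷ z ∷ x ∷ xs
v2 = there v1
v3 : ∀ {A : Set} {x y z w : A} {xs} → x ∈ y ∷ z ∷ w ∷ x ∷ xs
v3 = there v2
v4 : ∀ {A : Set} {x y z w u : A} {xs} → x ∈ y ∷ z ∷ w ∷ u ∷ x ∷ xs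
v4 = there v3
v5 : ∀ {A : Set} {x y z w u t : A} {xs} → x ∈ y ∷ z ∷ w ∷ u ∷ t ∷ x ∷ xs
v5 = there v4

-- Throughout, I = [a,b] and J = [c,d]; for an auxiliary interval K, k = lo K
-- and k' = hi K.
IntervalRel : Set₁
IntervalRel = ∀ {L} → Interval L → Interval L → Set

Endpoint : Set₁
Endpoint = ∀ {L} → Interval L → LinOrder.Carrier L

_≡ˡ_ _≡ʰ_ _<ˡ_ _>ˡ_ _<ʰ_ _<ˡʰ_ ii₀₄ʳ : IntervalRel
I ≡ˡ J = Interval.lo I ≡ Interval.lo J
I ≡ʰ J = Interval.hi I ≡ Interval.hi J
_<ˡ_ {L} I J = LinOrder._<_ L (Interval.lo I) (Interval.lo J)
I >ˡ J = J <ˡ I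
_<ʰ_ {L} I J = LinOrder._<_ L (Interval.hi I) (Interval.hi J)
_<ˡʰ_ {L} I J = LinOrder._<_ L (Interval.lo I) (Interval.hi J)
ii₀₄ʳ {L} = ⟦ ii₀₄ ⟧ʳ L

record Definable (S : List Sym) (R : IntervalRel) : Set₁ where
  field
    formula  : int ∈ Γ → int ∈ Γ → Formula S Γ
    sound    : {ρ : Env L Γ} {x y : int ∈ Γ} → Sat L (formula x y) ρ → R (lookup ρ x) (lookup ρ y)
    complete : {ρ : Env L Γ} {x y : int ∈ Γ} → R (lookup ρ x) (lookup ρ y) → Sat L (formula x y) ρ

<ˡ-by-ip₀ : ip₀ ∈ S → Definable S _<ˡ_
Definable.formula (<ˡ-by-ip₀ m) x y = ∃̇ pt (atom ip₀ m (there y) v0 ∧̇ (¬̇ atom ip₀ m (there x) v0))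
Definable.sound (<ˡ-by-ip₀ m) {L = L} (p , p<c , a≤p) = ≤-<-trans a≤p p<c
  where open LinOrderProperties L
Definable.complete (<ˡ-by-ip₀ m) {L = L} {ρ = ρ} {x} a<c = lo (lookup ρ x) , a<c , <-irrefl
  where open LinOrderProperties L

<ʰ-by-ip₄ : ip₄ ∈ S → Definable S _<ʰ_
Definable.formula (<ʰ-by-ip₄ m) x y = ∃̇ pt (atom ip₄ m (there x) v0 ∧̇ (¬̇ atom ip₄ m (there y) v0))
Definable.sound (<ʰ-by-ip₄ m) {L = L} (p , b<p , p≤d) = <-≤-trans b<p p≤d
  where open LinOrderProperties L
Definable.complete (<ʰ-by-ip₄ m) {L = L} {ρ = ρ} {y = y} b<d = hi (lookup ρ y) , b<d , <-irrefl
  where open LinOrderProperties L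

≡-by-< : (e : Endpoint) → Definable S (λ {L} I J → LinOrder._<_ L (e I) (e J))
       → Definable S (λ I J → e I ≡ e J)
Definable.formula (≡-by-< e D) x y = (¬̇ Definable.formula D x y) ∧̇ (¬̇ Definable.formula D y x)
Definable.sound (≡-by-< e D) {L = L} (x≮y , y≮x) =
  ≤-antisym (λ y<x → y≮x (Definable.complete D y<x)) (λ x<y → x≮y (Definable.complete D x<y))
  where open LinOrderProperties L
Definable.complete (≡-by-< e D) {L = L} {ρ = ρ} {x} {y} x≡y =
    (λ x<y → <-irrefl (subst (_< e (lookup ρ y)) x≡y (Definable.sound D x<y)))
  , (λ y<x → <-irrefl (subst (_< e (lookup ρ x)) (sym x≡y) (Definable.sound D y<x)))
  where open LinOrderProperties L

≡ˡ-by-ip₀ : ip₀ ∈ S → Definable S _≡ˡ_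
≡ˡ-by-ip₀ m = ≡-by-< Interval.lo (<ˡ-by-ip₀ m)

≡ʰ-by-ip₄ : ip₄ ∈ S → Definable S _≡ʰ_
≡ʰ-by-ip₄ m = ≡-by-< Interval.hi (<ʰ-by-ip₄ m)

≡ˡ-by-ip₁ : ip₁ ∈ S → Definable S _≡ˡ_
Definable.formula (≡ˡ-by-ip₁ m) x y = ∃̇ pt (atom ip₁ m (there x) v0 ∧̇ atom ip₁ m (there y) v0)
Definable.sound (≡ˡ-by-ip₁ m) (p , p≡a , p≡c) = trans (sym p≡a) p≡c
Definable.complete (≡ˡ-by-ip₁ m) {ρ = ρ} {x} a≡c = Interval.lo (lookup ρ x) , refl , a≡c

≡ʰ-by-ip₃ : ip₃ ∈ S → Definable S _≡ʰ_
Definable.formula (≡ʰ-by-ip₃ m) x y = ∃̇ pt (atom ip₃ m (there x) v0 ∧̇ atom ip₃ m (there y) v0)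
Definable.sound (≡ʰ-by-ip₃ m) (p , p≡b , p≡d) = trans (sym p≡b) p≡d
Definable.complete (≡ʰ-by-ip₃ m) {ρ = ρ} {x} b≡d = Interval.hi (lookup ρ x) , refl , b≡d

Γ₀ : List Sort
Γ₀ = int ∷ int ∷ []

⟨_,_⟩ : Interval L → Interval L → Env L Γ₀
⟨ I , J ⟩ = I ∷ᵃ J ∷ᵃ []ᵃ

record Between (S : List Sym) (R : IntervalRel) : Set₁ where
  field
    formula : Formula S Γ₀
    sound   : Sat L formula ⟨ I , J ⟩ → R I J
    covers  : ii₀₄ʳ I J → Sat L formula ⟨ I , J ⟩

complete-by : Between S ii₀₄ʳ → Complete S ii₀₄
complete-by B = formula , λ L I J → mk⇔ sound covers
  where open Between B

_∧ᵇ_ : {P Q : IntervalRel} → Between S P → Between S Q → Between S (λ I J → P I J × Q I J)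
Between.formula (A ∧ᵇ B) = Between.formula A ∧̇ Between.formula B
Between.sound   (A ∧ᵇ B) (a , b) = Between.sound A a , Between.sound B b
Between.covers  (A ∧ᵇ B) h = Between.covers A h , Between.covers B h

>ˡ-by-<ˡ : Definable S _<ˡ_ → Between S _>ˡ_
Between.formula (>ˡ-by-<ˡ D) = Definable.formula D v1 v0
Between.sound   (>ˡ-by-<ˡ D) = Definable.sound D
Between.covers  (>ˡ-by-<ˡ D) (c<a , _) = Definable.complete D c<a

<ʰ-by-<ʰ : Definable S _<ʰ_ → Between S _<ʰ_
Between.formula (<ʰ-by-<ʰ D) = Definable.formula D v0 v1
Between.sound   (<ʰ-by-<ʰ D) = Definable.sound D
Between.covers  (<ʰ-by-<ʰ D) (_ , b<d) = Definable.complete D b<d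

<ʰ-by-ip₂-≡ˡ : ip₂ ∈ S → Definable S _≡ˡ_ → Between S _<ʰ_
Between.formula (<ʰ-by-ip₂-≡ˡ m E) =
  ∃̇ pt (∃̇ int (Definable.formula E v0 v2 ∧̇ (atom ip₂ m v0 v1 ∧̇ (atom ip₂ m v3 v1 ∧̇ (¬̇ atom ip₂ m v2 v1)))))
Between.sound (<ʰ-by-ip₂-≡ˡ m E) {L = L} {I} (p , K , K≡ˡI , (k<p , _) , (_ , p<d) , p∉I) =
  ≤-<-trans (λ p<b → p∉I (subst (_< p) (Definable.sound E K≡ˡI) k<p , p<b)) p<d
  where open LinOrderProperties L
Between.covers (<ʰ-by-ip₂-≡ˡ m E) {L = L} {I} (c<a , b<d) =
  hi I , interval (<-trans (lo<hi I) b<d) , Definable.complete E refl , (lo<hi I , b<d) ,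
  (<-trans c<a (lo<hi I) , b<d) , <-irrefl ∘ proj₂
  where open LinOrderProperties L

>ˡ-by-ip₂-≡ʰ : ip₂ ∈ S → Definable S _≡ʰ_ → Between S _>ˡ_
Between.formula (>ˡ-by-ip₂-≡ʰ m E) =
  ∃̇ pt (∃̇ int (Definable.formula E v0 v2 ∧̇ (atom ip₂ m v0 v1 ∧̇ (atom ip₂ m v3 v1 ∧̇ (¬̇ atom ip₂ m v2 v1)))))
Between.sound (>ˡ-by-ip₂-≡ʰ m E) {L = L} {I} (p , K , K≡ʰI , (_ , p<k) , (c<p , _) , p∉I) =
  <-≤-trans c<p (λ a<p → p∉I (a<p , subst (p <_) (Definable.sound E K≡ʰI) p<k))
  where open LinOrderProperties L
Between.covers (>ˡ-by-ip₂-≡ʰ m E) {L = L} {I} (c<a , b<d) =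
  lo I , interval (<-trans c<a (lo<hi I)) , Definable.complete E refl , (c<a , lo<hi I) ,
  (c<a , <-trans (lo<hi I) b<d) , <-irrefl ∘ proj₁
  where open LinOrderProperties L

<ʰ-by-≡ʰ-<ˡ : Definable S _≡ʰ_ → Definable S _<ˡ_ → Between S _<ʰ_
Between.formula (<ʰ-by-≡ʰ-<ˡ E D) =
  ∃̇ int (Definable.formula E v0 v2 ∧̇ ∀̇ int (Definable.formula E v0 v2 ⇒̇ Definable.formula D v0 v1))
Between.sound (<ʰ-by-≡ʰ-<ˡ E D) {L = L} {I} (K , K≡ʰJ , below) =
  ≤-<-trans b≤k (subst (lo K <_) (Definable.sound E K≡ʰJ) (lo<hi K))
  where
  open LinOrderProperties L
  b≤k : hi I ≤ lo K
  b≤k k<b = <-irrefl (Definable.sound D (below (interval k<b) (Definable.complete E refl)))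
Between.covers (<ʰ-by-≡ʰ-<ˡ E D) {L = L} (_ , b<d) =
  interval b<d , Definable.complete E refl ,
  λ X X≡ʰI → Definable.complete D (subst (lo X <_) (Definable.sound E X≡ʰI) (lo<hi X))
  where open LinOrderProperties L

>ˡ-by-≡ˡ-<ʰ : Definable S _≡ˡ_ → Definable S _<ʰ_ → Between S _>ˡ_
Between.formula (>ˡ-by-≡ˡ-<ʰ E D) =
  ∃̇ int (Definable.formula E v0 v2 ∧̇ ∀̇ int (Definable.formula E v0 v2 ⇒̇ Definable.formula D v1 v0))
Between.sound (>ˡ-by-≡ˡ-<ʰ E D) {L = L} {I} (X , X≡ˡJ , above) =
  <-≤-trans (subst (_< hi X) (Definable.sound E X≡ˡJ) (lo<hi X)) x≤a
  where
  open LinOrderProperties L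
  x≤a : hi X ≤ lo I
  x≤a a<x = <-irrefl (Definable.sound D (above (interval a<x) (Definable.complete E refl)))
Between.covers (>ˡ-by-≡ˡ-<ʰ E D) {L = L} (c<a , _) =
  interval c<a , Definable.complete E refl ,
  λ Y Y≡ˡI → Definable.complete D (subst (_< hi Y) (Definable.sound E Y≡ˡI) (lo<hi Y))
  where open LinOrderProperties L

>ˡ-by-ip₁-ip₂ : ip₁ ∈ S → ip₂ ∈ S → Between S _>ˡ_
Between.formula (>ˡ-by-ip₁-ip₂ m₁ m₂) = ∃̇ pt (atom ip₁ m₁ v1 v0 ∧̇ atom ip₂ m₂ v2 v0)
Between.sound   (>ˡ-by-ip₁-ip₂ m₁ m₂) {L = L} {J = J} (p , p≡a , (c<p , _)) = subst (lo J <_) p≡a c<p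
  where open LinOrderProperties L
Between.covers  (>ˡ-by-ip₁-ip₂ m₁ m₂) {L = L} {I} (c<a , b<d) = lo I , refl , c<a , <-trans (lo<hi I) b<d
  where open LinOrderProperties L

<ʰ-by-ip₃-ip₂ : ip₃ ∈ S → ip₂ ∈ S → Between S _<ʰ_
Between.formula (<ʰ-by-ip₃-ip₂ m₃ m₂) = ∃̇ pt (atom ip₃ m₃ v1 v0 ∧̇ atom ip₂ m₂ v2 v0)
Between.sound   (<ʰ-by-ip₃-ip₂ m₃ m₂) {L = L} {J = J} (p , p≡b , (_ , p<d)) = subst (_< hi J) p≡b p<d
  where open LinOrderProperties L
Between.covers  (<ʰ-by-ip₃-ip₂ m₃ m₂) {L = L} {I} (c<a , b<d) = hi I , refl , <-trans c<a (lo<hi I) , b<d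
  where open LinOrderProperties L

>ˡ-by-ip₁-ip₃ : ip₁ ∈ S → ip₃ ∈ S → Between S _>ˡ_
Between.formula (>ˡ-by-ip₁-ip₃ m₁ m₃) =
  ∃̇ int (∃̇ pt (atom ip₁ m₁ v1 v0 ∧̇ atom ip₁ m₁ v3 v0) ∧̇ ∃̇ pt (atom ip₃ m₃ v1 v0 ∧̇ atom ip₁ m₁ v2 v0))
Between.sound (>ˡ-by-ip₁-ip₃ m₁ m₃) {L = L} (K , (p , p≡k , p≡c) , (q , q≡k , q≡a)) =
  subst₂ _<_ (trans (sym p≡k) p≡c) (trans (sym q≡k) q≡a) (lo<hi K)
  where open LinOrderProperties L
Between.covers (>ˡ-by-ip₁-ip₃ m₁ m₃) {L = L} {I} {J} (c<a , _) =
  interval c<a , (lo J , refl , refl) , (lo I , refl , refl)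
  where open LinOrderProperties L

<ʰ-by-ip₁-ip₃ : ip₁ ∈ S → ip₃ ∈ S → Between S _<ʰ_
Between.formula (<ʰ-by-ip₁-ip₃ m₁ m₃) =
  ∃̇ int (∃̇ pt (atom ip₁ m₁ v1 v0 ∧̇ atom ip₃ m₃ v2 v0) ∧̇ ∃̇ pt (atom ip₃ m₃ v1 v0 ∧̇ atom ip₃ m₃ v3 v0))
Between.sound (<ʰ-by-ip₁-ip₃ m₁ m₃) {L = L} (K , (p , p≡k , p≡b) , (q , q≡k , q≡d)) =
  subst₂ _<_ (trans (sym p≡k) p≡b) (trans (sym q≡k) q≡d) (lo<hi K)
  where open LinOrderProperties L
Between.covers (<ʰ-by-ip₁-ip₃ m₁ m₃) {L = L} {I} {J} (_ , b<d) =
  interval b<d , (hi I , refl , refl) , (hi J , refl , refl)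
  where open LinOrderProperties L

either : ∀ {k k'} → ii k k' ∈ S → int ∈ Γ → int ∈ Γ → Formula S Γ
either m x y = atom _ m x y ∨̇ atom _ m y x

ii₁₄-either⇒≡ˡ : (X Y : Interval L) → ⟦ ii₁₄ ⟧ʳ L X Y ⊎ ⟦ ii₁₄ ⟧ʳ L Y X → X ≡ˡ Y
ii₁₄-either⇒≡ˡ X Y (inj₁ (c≡a , _)) = sym c≡a
ii₁₄-either⇒≡ˡ X Y (inj₂ (a≡c , _)) = a≡c

ii₀₃-either⇒≡ʰ : (X Y : Interval L) → ⟦ ii₀₃ ⟧ʳ L X Y ⊎ ⟦ ii₀₃ ⟧ʳ L Y X → X ≡ʰ Y
ii₀₃-either⇒≡ʰ X Y (inj₁ (_ , d≡b)) = sym d≡b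
ii₀₃-either⇒≡ʰ X Y (inj₂ (_ , b≡d)) = b≡d

>ˡ-by-ip₂-ii₁₄ : ip₂ ∈ S → ii₁₄ ∈ S → Between S _>ˡ_
Between.formula (>ˡ-by-ip₂-ii₁₄ m₂ m₁₄) =
  ∃̇ pt (atom ip₂ m₂ v2 v0 ∧̇ ((¬̇ atom ip₂ m₂ v1 v0) ∧̇ ∀̇ int (either m₁₄ v0 v2 ⇒̇ (¬̇ atom ip₂ m₂ v0 v1))))
Between.sound (>ˡ-by-ip₂-ii₁₄ m₂ m₁₄) {L = L} {I} {J} (p , (c<p , p<d) , p∉I , avoid) = <-≤-trans c<p p≤a
  where
  open LinOrderProperties L
  p≤a : p ≤ lo I
  p≤a a<p with compare (hi I) (hi J)
  ... | tri< b<d _ _ = avoid (interval (<-trans a<p p<d)) (inj₂ (refl , b<d)) (a<p , p<d)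
  ... | tri≈ _ b≡d _ = p∉I (a<p , subst (p <_) (sym b≡d) p<d)
  ... | tri> _ _ d<b = avoid (interval (<-trans a<p p<d)) (inj₁ (refl , d<b)) (a<p , p<d)
Between.covers (>ˡ-by-ip₂-ii₁₄ m₂ m₁₄) {L = L} {I} (c<a , b<d) =
  lo I , (c<a , <-trans (lo<hi I) b<d) , <-irrefl ∘ proj₁ ,
  λ Z Z~I a∈Z → <-irrefl (subst (_< lo I) (ii₁₄-either⇒≡ˡ Z I Z~I) (proj₁ a∈Z))
  where open LinOrderProperties L

<ʰ-by-ip₂-ii₁₄ : ip₂ ∈ S → ii₁₄ ∈ S → Between S _<ʰ_
Between.formula (<ʰ-by-ip₂-ii₁₄ m₂ m₁₄) =
  ∃̇ pt (∃̇ int (atom ip₂ m₂ v3 v1 ∧̇ ((¬̇ atom ip₂ m₂ v2 v1) ∧̇ (either m₁₄ v0 v2 ∧̇ atom ip₂ m₂ v0 v1))))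
Between.sound (<ʰ-by-ip₂-ii₁₄ m₂ m₁₄) {L = L} {I} (q , Z , (_ , q<d) , q∉I , Z~I , (z<q , _)) =
  ≤-<-trans (λ q<b → q∉I (subst (_< q) (ii₁₄-either⇒≡ˡ Z I Z~I) z<q , q<b)) q<d
  where open LinOrderProperties L
Between.covers (<ʰ-by-ip₂-ii₁₄ m₂ m₁₄) {L = L} {I} (c<a , b<d) =
  hi I , interval (<-trans (lo<hi I) b<d) , (<-trans c<a (lo<hi I) , b<d) , <-irrefl ∘ proj₂ ,
  inj₂ (refl , b<d) , (lo<hi I , b<d)
  where open LinOrderProperties L

<ʰ-by-ip₂-ii₀₃ : ip₂ ∈ S → ii₀₃ ∈ S → Between S _<ʰ_
Between.formula (<ʰ-by-ip₂-ii₀₃ m₂ m₀₃) =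
  ∃̇ pt (atom ip₂ m₂ v2 v0 ∧̇ ((¬̇ atom ip₂ m₂ v1 v0) ∧̇ ∀̇ int (either m₀₃ v0 v2 ⇒̇ (¬̇ atom ip₂ m₂ v0 v1))))
Between.sound (<ʰ-by-ip₂-ii₀₃ m₂ m₀₃) {L = L} {I} {J} (p , (c<p , p<d) , p∉I , avoid) = ≤-<-trans b≤p p<d
  where
  open LinOrderProperties L
  b≤p : hi I ≤ p
  b≤p p<b with compare (lo J) (lo I)
  ... | tri< c<a _ _ = avoid (interval (<-trans c<p p<b)) (inj₂ (c<a , refl)) (c<p , p<b)
  ... | tri≈ _ c≡a _ = p∉I (subst (_< p) c≡a c<p , p<b)
  ... | tri> _ _ a<c = avoid (interval (<-trans c<p p<b)) (inj₁ (a<c , refl)) (c<p , p<b)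
Between.covers (<ʰ-by-ip₂-ii₀₃ m₂ m₀₃) {L = L} {I} (c<a , b<d) =
  hi I , (<-trans c<a (lo<hi I) , b<d) , <-irrefl ∘ proj₂ ,
  λ Z Z~I b∈Z → <-irrefl (subst (hi I <_) (ii₀₃-either⇒≡ʰ Z I Z~I) (proj₂ b∈Z))
  where open LinOrderProperties L

>ˡ-by-ip₂-ii₀₃ : ip₂ ∈ S → ii₀₃ ∈ S → Between S _>ˡ_
Between.formula (>ˡ-by-ip₂-ii₀₃ m₂ m₀₃) =
  ∃̇ pt (∃̇ int (atom ip₂ m₂ v3 v1 ∧̇ ((¬̇ atom ip₂ m₂ v2 v1) ∧̇ (either m₀₃ v0 v2 ∧̇ atom ip₂ m₂ v0 v1))))
Between.sound (>ˡ-by-ip₂-ii₀₃ m₂ m₀₃) {L = L} {I} (q , Z , (c<q , _) , q∉I , Z~I , (_ , q<z)) =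
  <-≤-trans c<q (λ a<q → q∉I (a<q , subst (q <_) (ii₀₃-either⇒≡ʰ Z I Z~I) q<z))
  where open LinOrderProperties L
Between.covers (>ˡ-by-ip₂-ii₀₃ m₂ m₀₃) {L = L} {I} (c<a , b<d) =
  lo I , interval (<-trans c<a (lo<hi I)) , (c<a , <-trans (lo<hi I) b<d) , <-irrefl ∘ proj₁ ,
  inj₂ (c<a , refl) , (c<a , lo<hi I)
  where open LinOrderProperties L

<ˡʰ-by-ii₄₄ : ii₄₄ ∈ S → Between S _<ˡʰ_
Between.formula (<ˡʰ-by-ii₄₄ m) =
  ∃̇ int (∃̇ int (atom ii₄₄ m v1 v0 ∧̇ ((¬̇ atom ii₄₄ m v1 v2) ∧̇ (¬̇ atom ii₄₄ m v3 v0))))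
Between.sound (<ˡʰ-by-ii₄₄ m) {L = L} {I} {J} (P , N , (p<n , _) , P≮I , J≮N) =
  ≤-<-trans a≤p (<-≤-trans p<n n≤d)
  where
  open LinOrderProperties L
  a≤p : lo I ≤ hi P
  a≤p p<a = P≮I (p<a , <-trans p<a (lo<hi I))
  n≤d : lo N ≤ hi J
  n≤d d<n = J≮N (d<n , <-trans d<n (lo<hi N))
Between.covers (<ˡʰ-by-ii₄₄ m) {L = L} {I} (c<a , b<d) =
  interval c<a , interval b<d , (lo<hi I , <-trans (lo<hi I) b<d) , <-irrefl ∘ proj₁ , <-asym b<d ∘ proj₁
  where open LinOrderProperties L

>ˡʰ-by-ii₄₄ : ii₄₄ ∈ S → Between S (λ I J → J <ˡʰ I)
Between.formula (>ˡʰ-by-ii₄₄ m) =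
  ∃̇ int (∃̇ int (atom ii₄₄ m v0 v1 ∧̇ ((¬̇ atom ii₄₄ m v2 v1) ∧̇ (¬̇ atom ii₄₄ m v0 v3))))
Between.sound (>ˡʰ-by-ii₄₄ m) {L = L} {I} {J} (P , N , (n<p , _) , I≮P , N≮J) =
  ≤-<-trans c≤n (<-≤-trans n<p p≤b)
  where
  open LinOrderProperties L
  c≤n : lo J ≤ hi N
  c≤n n<c = N≮J (n<c , <-trans n<c (lo<hi J))
  p≤b : lo P ≤ hi I
  p≤b b<p = I≮P (b<p , <-trans b<p (lo<hi P))
Between.covers (>ˡʰ-by-ii₄₄ m) {L = L} {I} (c<a , b<d) =
  interval b<d , interval c<a , (lo<hi I , <-trans (lo<hi I) b<d) , <-irrefl ∘ proj₁ , <-asym c<a ∘ proj₁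
  where open LinOrderProperties L

-- Witnesses K = [c,b] and M = [a,d]: ii₂₄(K,M) gives c < a, and the two failures
-- of ii₂₄ push b ≤ k' < m' ≤ d.
ii₀₄-by-≡ˡ-ii₂₄-ii₄₄ : Definable S _≡ˡ_ → ii₂₄ ∈ S → ii₄₄ ∈ S → Between S ii₀₄ʳ
Between.formula (ii₀₄-by-≡ˡ-ii₂₄-ii₄₄ E m₂₄ m₄₄) =
  ∃̇ int (∃̇ int (Definable.formula E v1 v3 ∧̇ (Definable.formula E v0 v2 ∧̇
    (atom ii₂₄ m₂₄ v1 v0 ∧̇ ((¬̇ atom ii₂₄ m₂₄ v1 v2) ∧̇ (¬̇ atom ii₂₄ m₂₄ v3 v0))))))
  ∧̇ Between.formula (<ˡʰ-by-ii₄₄ m₄₄)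
Between.sound (ii₀₄-by-≡ˡ-ii₂₄-ii₄₄ E m₂₄ m₄₄) {L = L} {I} {J}
  ((K , M , K≡ˡJ , M≡ˡI , ((k<m , m<k') , k'<m') , K≮I , J≮M) , a<d-witness) = c<a , b<d
  where
  open LinOrderProperties L
  a<d : lo I < hi J
  a<d = Between.sound (<ˡʰ-by-ii₄₄ m₄₄) {I = I} {J} a<d-witness
  c≡k : lo K ≡ lo J
  c≡k = Definable.sound E K≡ˡJ
  m≡a : lo M ≡ lo I
  m≡a = Definable.sound E M≡ˡI
  c<a : lo J < lo I
  c<a = subst₂ _<_ c≡k m≡a k<m
  b≤k' : hi I ≤ hi K
  b≤k' k'<b = K≮I ((subst (lo K <_) m≡a k<m , subst (_< hi K) m≡a m<k') , k'<b)
  m'≤d : hi M ≤ hi J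
  m'≤d d<m' = J≮M ((subst (_< lo M) c≡k k<m , subst (_< hi J) (sym m≡a) a<d) , d<m')
  b<d : hi I < hi J
  b<d = ≤-<-trans b≤k' (<-≤-trans k'<m' m'≤d)
Between.covers (ii₀₄-by-≡ˡ-ii₂₄-ii₄₄ E m₂₄ m₄₄) {L = L} {I} {J} (c<a , b<d) =
  ( interval (<-trans c<a (lo<hi I)) , interval (<-trans (lo<hi I) b<d)
  , Definable.complete E refl , Definable.complete E refl
  , ((c<a , lo<hi I) , b<d) , <-irrefl ∘ proj₂ , <-irrefl ∘ proj₂ )
  , Between.covers (<ˡʰ-by-ii₄₄ m₄₄) {I = I} {J} (c<a , b<d)
  where open LinOrderProperties L

ii₀₄-by-≡ʰ-ii₂₄-ii₄₄ : Definable S _≡ʰ_ → ii₂₄ ∈ S → ii₄₄ ∈ S → Between S ii₀₄ʳ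
Between.formula (ii₀₄-by-≡ʰ-ii₂₄-ii₄₄ E m₂₄ m₄₄) =
  ∃̇ int (∃̇ int (Definable.formula E v1 v3 ∧̇ (Definable.formula E v0 v2 ∧̇
    (atom ii₂₄ m₂₄ v0 v1 ∧̇ ((¬̇ atom ii₂₄ m₂₄ v2 v1) ∧̇ (¬̇ atom ii₂₄ m₂₄ v0 v3))))))
  ∧̇ Between.formula (>ˡʰ-by-ii₄₄ m₄₄)
Between.sound (ii₀₄-by-≡ʰ-ii₂₄-ii₄₄ E m₂₄ m₄₄) {L = L} {I} {J}
  ((K , M , K≡ʰJ , M≡ʰI , ((m<k , k<m') , m'<k') , I≮K , M≮J) , c<b-witness) = c<a , b<d
  where
  open LinOrderProperties L
  c<b : lo J < hi I
  c<b = Between.sound (>ˡʰ-by-ii₄₄ m₄₄) {I = I} {J} c<b-witness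
  k'≡d : hi K ≡ hi J
  k'≡d = Definable.sound E K≡ʰJ
  m'≡b : hi M ≡ hi I
  m'≡b = Definable.sound E M≡ʰI
  b<d : hi I < hi J
  b<d = subst₂ _<_ m'≡b k'≡d m'<k'
  k≤a : lo K ≤ lo I
  k≤a a<k = I≮K ((a<k , subst (lo K <_) m'≡b k<m') , subst (hi I <_) (sym k'≡d) b<d)
  c≤m : lo J ≤ lo M
  c≤m m<c = M≮J ((m<c , subst (lo J <_) (sym m'≡b) c<b) , subst (_< hi J) (sym m'≡b) b<d)
  c<a : lo J < lo I
  c<a = ≤-<-trans c≤m (<-≤-trans m<k k≤a)
Between.covers (ii₀₄-by-≡ʰ-ii₂₄-ii₄₄ E m₂₄ m₄₄) {L = L} {I} {J} (c<a , b<d) =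
  ( interval (<-trans (lo<hi I) b<d) , interval (<-trans c<a (lo<hi I))
  , Definable.complete E refl , Definable.complete E refl
  , ((c<a , lo<hi I) , b<d) , <-irrefl ∘ proj₁ ∘ proj₁ , <-irrefl ∘ proj₁ ∘ proj₁ )
  , Between.covers (>ˡʰ-by-ii₄₄ m₄₄) {I = I} {J} (c<a , b<d)
  where open LinOrderProperties L

-- Witnesses M = [a,d] and Z = [b,d]; as no interval ending at b starts at lo Z,
-- b ≤ lo Z.
ii₀₄-by-≡ˡ-ii₀₃ : Definable S _≡ˡ_ → ii₀₃ ∈ S → Between S ii₀₄ʳ
Between.formula (ii₀₄-by-≡ˡ-ii₀₃ E m) =
  ∃̇ int (∃̇ int (Definable.formula E v1 v2 ∧̇ (atom ii₀₃ m v1 v3 ∧̇ (atom ii₀₃ m v0 v1 ∧̇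
    ∀̇ int (atom ii₀₃ m v0 v3 ⇒̇ (¬̇ Definable.formula E v0 v1))))))
Between.sound (ii₀₄-by-≡ˡ-ii₀₃ E m) {L = L} {I} {J}
  (M , Z , M≡ˡI , (c<m , d≡m') , (m<z , m'≡z') , noY) = c<a , ≤-<-trans b≤z z<d
  where
  open LinOrderProperties L
  m≡a : lo M ≡ lo I
  m≡a = Definable.sound E M≡ˡI
  c<a : lo J < lo I
  c<a = subst (lo J <_) m≡a c<m
  b≤z : hi I ≤ lo Z
  b≤z z<b = noY (interval z<b) (subst (_< lo Z) m≡a m<z , refl) (Definable.complete E refl)
  z<d : lo Z < hi J
  z<d = subst (lo Z <_) (sym (trans d≡m' m'≡z')) (lo<hi Z)
Between.covers (ii₀₄-by-≡ˡ-ii₀₃ E m) {L = L} {I} (c<a , b<d) =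
  interval (<-trans (lo<hi I) b<d) , interval b<d , Definable.complete E refl , (c<a , refl) , (lo<hi I , refl) ,
  λ Y (_ , b≡y') Y≡ˡZ → <-irrefl (subst₂ _<_ (Definable.sound E Y≡ˡZ) (sym b≡y') (lo<hi Y))
  where open LinOrderProperties L

ii₀₄-by-≡ʰ-ii₁₄ : Definable S _≡ʰ_ → ii₁₄ ∈ S → Between S ii₀₄ʳ
Between.formula (ii₀₄-by-≡ʰ-ii₁₄ E m) =
  ∃̇ int (∃̇ int (Definable.formula E v1 v2 ∧̇ (atom ii₁₄ m v1 v3 ∧̇ (atom ii₁₄ m v0 v1 ∧̇
    ∀̇ int (atom ii₁₄ m v0 v3 ⇒̇ (¬̇ Definable.formula E v0 v1))))))
Between.sound (ii₀₄-by-≡ʰ-ii₁₄ E m) {L = L} {I} {J}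
  (M , Z , M≡ʰI , (c≡m , m'<d) , (m≡z , z'<m') , noY) = <-≤-trans c<z' z'≤a , b<d
  where
  open LinOrderProperties L
  m'≡b : hi M ≡ hi I
  m'≡b = Definable.sound E M≡ʰI
  b<d : hi I < hi J
  b<d = subst (_< hi J) m'≡b m'<d
  z'≤a : hi Z ≤ lo I
  z'≤a a<z' = noY (interval a<z') (refl , subst (hi Z <_) m'≡b z'<m') (Definable.complete E refl)
  c<z' : lo J < hi Z
  c<z' = subst (_< hi Z) (sym (trans c≡m m≡z)) (lo<hi Z)
Between.covers (ii₀₄-by-≡ʰ-ii₁₄ E m) {L = L} {I} (c<a , b<d) =
  interval (<-trans c<a (lo<hi I)) , interval c<a , Definable.complete E refl , (refl , b<d) , (refl , lo<hi I) ,
  λ Y (a≡y , _) Y≡ʰZ → <-irrefl (subst₂ _<_ (sym a≡y) (Definable.sound E Y≡ʰZ) (lo<hi Y))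
  where open LinOrderProperties L

ii₀₄-by-ii₁₄-ii₂₄ : ii₁₄ ∈ S → ii₂₄ ∈ S → Between S ii₀₄ʳ
Between.formula (ii₀₄-by-ii₁₄-ii₂₄ m₁₄ m₂₄) =
  ∃̇ int (∃̇ int (atom ii₁₄ m₁₄ v1 v3 ∧̇ (atom ii₁₄ m₁₄ v2 v0 ∧̇ (atom ii₂₄ m₂₄ v1 v0 ∧̇ (¬̇ atom ii₂₄ m₂₄ v1 v2)))))
Between.sound (ii₀₄-by-ii₁₄-ii₂₄ m₁₄ m₂₄) {L = L}
  (K , M , (c≡k , k'<d) , (m≡a , _) , ((k<m , m<k') , _) , K≮I) =
  subst₂ _<_ (sym c≡k) m≡a k<m ,
  ≤-<-trans (λ k'<b → K≮I ((subst (lo K <_) m≡a k<m , subst (_< hi K) m≡a m<k') , k'<b)) k'<d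
  where open LinOrderProperties L
Between.covers (ii₀₄-by-ii₁₄-ii₂₄ m₁₄ m₂₄) {L = L} {I} (c<a , b<d) =
  interval (<-trans c<a (lo<hi I)) , interval (<-trans (lo<hi I) b<d) , (refl , b<d) , (refl , b<d) ,
  ((c<a , lo<hi I) , b<d) , <-irrefl ∘ proj₂
  where open LinOrderProperties L

ii₀₄-by-ii₂₄-ii₀₃ : ii₂₄ ∈ S → ii₀₃ ∈ S → Between S ii₀₄ʳ
Between.formula (ii₀₄-by-ii₂₄-ii₀₃ m₂₄ m₀₃) =
  ∃̇ int (∃̇ int (atom ii₀₃ m₀₃ v1 v3 ∧̇ (atom ii₀₃ m₀₃ v2 v0 ∧̇ (atom ii₂₄ m₂₄ v0 v1 ∧̇ (¬̇ atom ii₂₄ m₂₄ v2 v1)))))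
Between.sound (ii₀₄-by-ii₂₄-ii₀₃ m₂₄ m₀₃) {L = L} {I} {J}
  (K , M , (c<k , d≡k') , (_ , m'≡b) , ((_ , k<m') , m'<k') , I≮K) = c<a , b<d
  where
  open LinOrderProperties L
  b<d : hi I < hi J
  b<d = subst₂ _<_ m'≡b (sym d≡k') m'<k'
  c<a : lo J < lo I
  c<a = <-≤-trans c<k (λ a<k → I≮K ((a<k , subst (lo K <_) m'≡b k<m') , subst (hi I <_) d≡k' b<d))
Between.covers (ii₀₄-by-ii₂₄-ii₀₃ m₂₄ m₀₃) {L = L} {I} (c<a , b<d) =
  interval (<-trans (lo<hi I) b<d) , interval (<-trans c<a (lo<hi I)) , (c<a , refl) , (c<a , refl) ,
  ((c<a , lo<hi I) , b<d) , <-irrefl ∘ proj₁ ∘ proj₁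
  where open LinOrderProperties L

ii₀₄-by-ii₁₄-ii₀₃ : ii₁₄ ∈ S → ii₀₃ ∈ S → Between S ii₀₄ʳ
Between.formula (ii₀₄-by-ii₁₄-ii₀₃ m₁₄ m₀₃) = ∃̇ int (atom ii₁₄ m₁₄ v1 v0 ∧̇ atom ii₀₃ m₀₃ v0 v2)
Between.sound (ii₀₄-by-ii₁₄-ii₀₃ m₁₄ m₀₃) {L = L} {I} {J} (K , (k≡a , b<k') , (c<k , d≡k')) =
  subst (lo J <_) k≡a c<k , subst (hi I <_) (sym d≡k') b<k'
  where open LinOrderProperties L
Between.covers (ii₀₄-by-ii₁₄-ii₀₃ m₁₄ m₀₃) {L = L} {I} (c<a , b<d) =
  interval (<-trans (lo<hi I) b<d) , (refl , b<d) , (c<a , refl)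
  where open LinOrderProperties L

ii₀₄-by-ii₃₄ : ii₃₄ ∈ S → Between S ii₀₄ʳ
Between.formula (ii₀₄-by-ii₃₄ m) =
  ∃̇ int (∃̇ int (atom ii₃₄ m v1 v2 ∧̇ (atom ii₃₄ m v2 v0 ∧̇
    (∀̇ int (atom ii₃₄ m v0 v4 ⇒̇ atom ii₃₄ m v0 v2) ∧̇ ∀̇ int (atom ii₃₄ m v4 v0 ⇒̇ atom ii₃₄ m v1 v0)))))
Between.sound (ii₀₄-by-ii₃₄ m) {L = L} {I} {J} (K , N , (a≡k' , _) , (n≡b , _) , meetsK , metByN) =
  ≤-<-trans c≤k (subst (lo K <_) (sym a≡k') (lo<hi K)) , <-≤-trans (subst (_< hi N) n≡b (lo<hi N)) n'≤d
  where
  open LinOrderProperties L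
  c≤k : lo J ≤ lo K
  c≤k k<c = <-irrefl (subst (_< lo J) (proj₁ (meetsK (interval k<c) (refl , lo<hi J))) k<c)
  n'≤d : hi N ≤ hi J
  n'≤d d<n' = <-irrefl (subst (_< hi N) (proj₁ (metByN (interval d<n') (refl , d<n'))) d<n')
Between.covers (ii₀₄-by-ii₃₄ m) {L = L} {I} (c<a , b<d) =
  interval c<a , interval b<d , (refl , lo<hi I) , (refl , b<d) ,
  (λ W (c≡w' , _) → c≡w' , subst (_< lo I) c≡w' c<a) , (λ W meets → meets)
  where open LinOrderProperties L

interior⊆ : ip₂ ∈ S → int ∈ Γ → int ∈ Γ → Formula S Γ
interior⊆ m x y = ∀̇ pt (atom ip₂ m (there x) v0 ⇒̇ atom ip₂ m (there y) v0)

-- Witnesses K = [c,b] and M = [a,d]; the ii₄₄ clauses give k' ≤ b and a ≤ m, the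
-- interior inclusions the converse, and then a ∈ K° ⊆ J° and b ∈ M° ⊆ J°.
ii₀₄-by-ip₂-ii₂₄-ii₄₄ : ip₂ ∈ S → ii₂₄ ∈ S → ii₄₄ ∈ S → Between S ii₀₄ʳ
Between.formula (ii₀₄-by-ip₂-ii₂₄-ii₄₄ m₂ m₂₄ m₄₄) =
  ∃̇ int (∃̇ int (atom ii₂₄ m₂₄ v1 v0 ∧̇ (interior⊆ m₂ v2 v1 ∧̇ (interior⊆ m₂ v2 v0 ∧̇
    (interior⊆ m₂ v1 v3 ∧̇ (interior⊆ m₂ v0 v3 ∧̇
    (∀̇ int (atom ii₄₄ m₄₄ v3 v0 ⇒̇ atom ii₄₄ m₄₄ v2 v0) ∧̇ ∀̇ int (atom ii₄₄ m₄₄ v0 v3 ⇒̇ atom ii₄₄ m₄₄ v0 v1))))))))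
Between.sound (ii₀₄-by-ip₂-ii₂₄-ii₄₄ m₂ m₂₄ m₄₄) {L = L} {I}
  (K , M , ((k<m , m<k') , k'<m') , I⊆K , I⊆M , K⊆J , M⊆J , afterI⇒afterK , beforeI⇒beforeM) =
  proj₁ (K⊆J (lo I) (<-≤-trans k<m m≤a , ≤-<-trans a≤m m<k')) ,
  proj₂ (M⊆J (hi I) (<-≤-trans m<k' k'≤b , ≤-<-trans b≤k' k'<m'))
  where
  open LinOrderProperties L
  a≤m : lo I ≤ lo M
  a≤m m<a = <-irrefl (proj₁ (beforeI⇒beforeM (interval k<m) (m<a , <-trans m<a (lo<hi I))))
  k'≤b : hi K ≤ hi I
  k'≤b b<k' = <-irrefl (proj₁ (afterI⇒afterK (interval k'<m') (b<k' , <-trans b<k' k'<m')))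
  b≤k' : hi I ≤ hi K
  b≤k' k'<b = <-irrefl (proj₂ (I⊆K (hi K) (≤-<-trans a≤m m<k' , k'<b)))
  m≤a : lo M ≤ lo I
  m≤a a<m = <-irrefl (proj₁ (I⊆M (lo M) (a<m , <-≤-trans m<k' k'≤b)))
Between.covers (ii₀₄-by-ip₂-ii₂₄-ii₄₄ m₂ m₂₄ m₄₄) {L = L} {I} (c<a , b<d) =
  interval (<-trans c<a (lo<hi I)) , interval (<-trans (lo<hi I) b<d) , ((c<a , lo<hi I) , b<d) ,
  (λ p (a<p , p<b) → <-trans c<a a<p , p<b) , (λ p (a<p , p<b) → a<p , <-trans p<b b<d) ,
  (λ p (c<p , p<b) → c<p , <-trans p<b b<d) , (λ p (a<p , p<d) → <-trans c<a a<p , p<d) ,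
  (λ W after → after) , (λ W (w'<a , _) → w'<a , <-trans w'<a (<-trans (lo<hi I) b<d))
  where open LinOrderProperties L

-- Witnesses K = [c,b], M = [a,d], p = a and q = b.
ii₀₄-by-ip₂-ii₄₄-< : ip₂ ∈ S → ii₄₄ ∈ S → lt ∈ S → Between S ii₀₄ʳ
Between.formula (ii₀₄-by-ip₂-ii₄₄-< m₂ m₄₄ m<) =
  ∃̇ int (∃̇ int (∃̇ pt (∃̇ pt (atom lt m< v1 v0 ∧̇
    (atom ip₂ m₂ v3 v1 ∧̇ ((¬̇ atom ip₂ m₂ v2 v1) ∧̇ (atom ip₂ m₂ v2 v0 ∧̇ ((¬̇ atom ip₂ m₂ v3 v0) ∧̇
    ((¬̇ atom ip₂ m₂ v4 v1) ∧̇ ((¬̇ atom ip₂ m₂ v4 v0) ∧̇ (atom ip₂ m₂ v5 v1 ∧̇ (atom ip₂ m₂ v5 v0 ∧̇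
    (∀̇ int (atom ii₄₄ m₄₄ v0 v5 ⇒̇ atom ii₄₄ m₄₄ v0 v3) ∧̇ ∀̇ int (atom ii₄₄ m₄₄ v5 v0 ⇒̇ atom ii₄₄ m₄₄ v4 v0))))))))))))))
Between.sound (ii₀₄-by-ip₂-ii₄₄-< m₂ m₄₄ m<) {L = L} {I}
  (K , M , p , q , p<q , (k<p , p<k') , p∉M , (m<q , q<m') , q∉K , p∉I , q∉I , (c<p , _) , (_ , q<d) ,
   beforeI⇒beforeM , afterI⇒afterK) =
  <-≤-trans c<p p≤a , ≤-<-trans b≤q q<d
  where
  open LinOrderProperties L
  k<m : lo K < lo M
  k<m = <-≤-trans k<p (λ m<p → p∉M (m<p , <-trans p<q q<m'))
  k'<m' : hi K < hi M
  k'<m' = ≤-<-trans (λ q<k' → q∉K (<-trans k<p p<q , q<k')) q<m'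
  a≤m : lo I ≤ lo M
  a≤m m<a = <-irrefl (proj₁ (beforeI⇒beforeM (interval k<m) (m<a , <-trans m<a (lo<hi I))))
  k'≤b : hi K ≤ hi I
  k'≤b b<k' = <-irrefl (proj₁ (afterI⇒afterK (interval k'<m') (b<k' , <-trans b<k' k'<m')))
  p≤a : p ≤ lo I
  p≤a a<p = p∉I (a<p , <-≤-trans p<k' k'≤b)
  b≤q : hi I ≤ q
  b≤q q<b = q∉I (≤-<-trans a≤m m<q , q<b)
Between.covers (ii₀₄-by-ip₂-ii₄₄-< m₂ m₄₄ m<) {L = L} {I} (c<a , b<d) =
  interval (<-trans c<a (lo<hi I)) , interval (<-trans (lo<hi I) b<d) , lo I , hi I , lo<hi I ,
  (c<a , lo<hi I) , <-irrefl ∘ proj₁ , (lo<hi I , b<d) , <-irrefl ∘ proj₂ , <-irrefl ∘ proj₁ , <-irrefl ∘ proj₂ ,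
  (c<a , <-trans (lo<hi I) b<d) , (<-trans c<a (lo<hi I) , b<d) ,
  (λ W (w'<a , _) → w'<a , <-trans w'<a (<-trans (lo<hi I) b<d)) , (λ W after → after)
  where open LinOrderProperties L

-- Witnesses K = [c,b] and M = [a,d]: the ii₄₄ clauses force k' = b, the negated
-- conjunct excludes a = c and the nested clause excludes a < c.
ii₀₄-by-ii₁₄-ii₄₄ : ii₁₄ ∈ S → ii₄₄ ∈ S → Between S ii₀₄ʳ
Between.formula (ii₀₄-by-ii₁₄-ii₄₄ m₁₄ m₄₄) =
  ∃̇ int (∃̇ int (atom ii₁₄ m₁₄ v1 v3 ∧̇ (atom ii₁₄ m₁₄ v2 v0 ∧̇
    (∀̇ int (atom ii₄₄ m₄₄ v3 v0 ⇒̇ atom ii₄₄ m₄₄ v2 v0) ∧̇ (∀̇ int (atom ii₄₄ m₄₄ v2 v0 ⇒̇ atom ii₄₄ m₄₄ v3 v0) ∧̇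
    ∀̇ int (atom ii₁₄ m₁₄ v0 v3 ⇒̇ ∃̇ int (atom ii₁₄ m₁₄ v0 v3 ∧̇ ∀̇ int (atom ii₄₄ m₄₄ v2 v0 ⇒̇ atom ii₄₄ m₄₄ v1 v0))))))))
  ∧̇ (¬̇ atom ii₁₄ m₁₄ v0 v1)
Between.sound (ii₀₄-by-ii₁₄-ii₄₄ m₁₄ m₄₄) {L = L} {I} {J}
  ((K , M , (c≡k , k'<d) , (_ , b<m') , afterI⇒afterK , afterK⇒afterI , shorten) , I≢J) = c<a , b<d
  where
  open LinOrderProperties L
  k'≡b : hi K ≡ hi I
  k'≡b = ≤-antisym (λ b<k' → <-irrefl (proj₁ (afterI⇒afterK (interval k'<d) (b<k' , <-trans b<k' k'<d))))
                   (λ k'<b → <-irrefl (proj₁ (afterK⇒afterI (interval b<m') (k'<b , <-trans k'<b b<m'))))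
  b<d : hi I < hi J
  b<d = subst (_< hi J) k'≡b k'<d
  c<b : lo J < hi I
  c<b = subst₂ _<_ (sym c≡k) k'≡b (lo<hi K)
  a≮c : ¬ lo I < lo J
  a≮c a<c with shorten (interval a<c) (refl , c<b)
  ... | U , (k≡u , u'<k') , afterW⇒afterU =
    <-irrefl (proj₁ (afterW⇒afterU (interval (subst (hi U <_) k'≡b u'<k')) (c<u' , <-trans c<u' u'<b)))
    where
    c<u' : lo J < hi U
    c<u' = subst (_< hi U) (sym (trans c≡k k≡u)) (lo<hi U)
    u'<b : hi U < hi I
    u'<b = subst (hi U <_) k'≡b u'<k'
  c<a : lo J < lo I
  c<a with compare (lo J) (lo I)
  ... | tri< c<a _ _ = c<a
  ... | tri≈ _ c≡a _ = ⊥-elim (I≢J (c≡a , b<d))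
  ... | tri> _ _ a<c = ⊥-elim (a≮c a<c)
Between.covers (ii₀₄-by-ii₁₄-ii₄₄ m₁₄ m₄₄) {L = L} {I} (c<a , b<d) =
  ( interval (<-trans c<a (lo<hi I)) , interval (<-trans (lo<hi I) b<d) , (refl , b<d) , (refl , b<d)
  , (λ W after → after) , (λ W after → after)
  , λ W (a≡w , w'<b) → interval (<-trans c<a (subst (_< hi W) (sym a≡w) (lo<hi W))) , (refl , w'<b) , λ V after → after )
  , λ (c≡a , _) → <-irrefl (subst (_< lo I) c≡a c<a)
  where open LinOrderProperties L

-- The mirror image of ii₀₄-by-ii₁₄-ii₄₄, with K = [a,d] and M = [c,b].
ii₀₄-by-ii₀₃-ii₄₄ : ii₀₃ ∈ S → ii₄₄ ∈ S → Between S ii₀₄ʳ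
Between.formula (ii₀₄-by-ii₀₃-ii₄₄ m₀₃ m₄₄) =
  ∃̇ int (∃̇ int (atom ii₀₃ m₀₃ v1 v3 ∧̇ (atom ii₀₃ m₀₃ v2 v0 ∧̇
    (∀̇ int (atom ii₄₄ m₄₄ v0 v3 ⇒̇ atom ii₄₄ m₄₄ v0 v2) ∧̇ (∀̇ int (atom ii₄₄ m₄₄ v0 v2 ⇒̇ atom ii₄₄ m₄₄ v0 v3) ∧̇
    ∀̇ int (atom ii₀₃ m₀₃ v0 v3 ⇒̇ ∃̇ int (atom ii₀₃ m₀₃ v0 v3 ∧̇ ∀̇ int (atom ii₄₄ m₄₄ v0 v2 ⇒̇ atom ii₄₄ m₄₄ v0 v1))))))))
  ∧̇ (¬̇ atom ii₀₃ m₀₃ v0 v1)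
Between.sound (ii₀₄-by-ii₀₃-ii₄₄ m₀₃ m₄₄) {L = L} {I} {J}
  ((K , M , (c<k , d≡k') , (m<a , _) , beforeI⇒beforeK , beforeK⇒beforeI , shorten) , I≢J) = c<a , b<d
  where
  open LinOrderProperties L
  k≡a : lo K ≡ lo I
  k≡a = ≤-antisym (λ a<k → <-irrefl (proj₁ (beforeK⇒beforeI (interval m<a) (a<k , <-trans a<k (lo<hi K)))))
                  (λ k<a → <-irrefl (proj₁ (beforeI⇒beforeK (interval c<k) (k<a , <-trans k<a (lo<hi I)))))
  c<a : lo J < lo I
  c<a = subst (lo J <_) k≡a c<k
  a<d : lo I < hi J
  a<d = subst₂ _<_ k≡a (sym d≡k') (lo<hi K)
  d≮b : ¬ hi J < hi I
  d≮b d<b with shorten (interval d<b) (a<d , refl)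
  ... | U , (k<u , k'≡u') , beforeW⇒beforeU =
    <-irrefl (proj₁ (beforeW⇒beforeU (interval (subst (_< lo U) k≡a k<u)) (u<d , <-trans u<d d<b)))
    where
    u<d : lo U < hi J
    u<d = subst (lo U <_) (sym (trans d≡k' k'≡u')) (lo<hi U)
  b<d : hi I < hi J
  b<d with compare (hi I) (hi J)
  ... | tri< b<d _ _ = b<d
  ... | tri≈ _ b≡d _ = ⊥-elim (I≢J (c<a , sym b≡d))
  ... | tri> _ _ d<b = ⊥-elim (d≮b d<b)
Between.covers (ii₀₄-by-ii₀₃-ii₄₄ m₀₃ m₄₄) {L = L} {I} (c<a , b<d) =
  ( interval (<-trans (lo<hi I) b<d) , interval (<-trans c<a (lo<hi I)) , (c<a , refl) , (c<a , refl)
  , (λ W (w'<a , _) → w'<a , <-trans w'<a (<-trans (lo<hi I) b<d)) , (λ W (w'<a , _) → w'<a , <-trans w'<a (lo<hi I))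
  , λ W (a<w , b≡w') → let w<d = <-trans (subst (lo W <_) (sym b≡w') (lo<hi W)) b<d in
      interval w<d , (a<w , refl) , λ V (v'<w , _) → v'<w , <-trans v'<w w<d )
  , λ (_ , d≡b) → <-irrefl (subst (hi I <_) d≡b b<d)
  where open LinOrderProperties L

lemma3p12 : All (λ S → Complete S ii₀₄) lemmaSets
lemma3p12 =
     complete-by (ii₀₄-by-≡ˡ-ii₂₄-ii₄₄ (≡ˡ-by-ip₀ v0) v1 v2)
  ∷ᵃ complete-by (ii₀₄-by-≡ʰ-ii₂₄-ii₄₄ (≡ʰ-by-ip₄ v0) v1 v2)
  ∷ᵃ complete-by (ii₀₄-by-≡ˡ-ii₂₄-ii₄₄ (≡ˡ-by-ip₁ v0) v1 v2)
  ∷ᵃ complete-by (ii₀₄-by-≡ʰ-ii₂₄-ii₄₄ (≡ʰ-by-ip₃ v0) v1 v2)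
  ∷ᵃ complete-by (ii₀₄-by-ip₂-ii₂₄-ii₄₄ v0 v1 v2)
  ∷ᵃ complete-by (>ˡ-by-<ˡ (<ˡ-by-ip₀ v0) ∧ᵇ <ʰ-by-ip₂-≡ˡ v1 (≡ˡ-by-ip₀ v0))
  ∷ᵃ complete-by (>ˡ-by-<ˡ (<ˡ-by-ip₀ v0) ∧ᵇ <ʰ-by-≡ʰ-<ˡ (≡ʰ-by-ip₃ v1) (<ˡ-by-ip₀ v0))
  ∷ᵃ complete-by (>ˡ-by-<ˡ (<ˡ-by-ip₀ v0) ∧ᵇ <ʰ-by-<ʰ (<ʰ-by-ip₄ v1))
  ∷ᵃ complete-by (ii₀₄-by-≡ˡ-ii₀₃ (≡ˡ-by-ip₀ v0) v1)
  ∷ᵃ complete-by (>ˡ-by-ip₁-ip₂ v0 v1 ∧ᵇ <ʰ-by-ip₂-≡ˡ v1 (≡ˡ-by-ip₁ v0))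
  ∷ᵃ complete-by (>ˡ-by-ip₁-ip₃ v0 v1 ∧ᵇ <ʰ-by-ip₁-ip₃ v0 v1)
  ∷ᵃ complete-by (>ˡ-by-≡ˡ-<ʰ (≡ˡ-by-ip₁ v0) (<ʰ-by-ip₄ v1) ∧ᵇ <ʰ-by-<ʰ (<ʰ-by-ip₄ v1))
  ∷ᵃ complete-by (ii₀₄-by-≡ˡ-ii₀₃ (≡ˡ-by-ip₁ v0) v1)
  ∷ᵃ complete-by (>ˡ-by-ip₂-≡ʰ v0 (≡ʰ-by-ip₃ v1) ∧ᵇ <ʰ-by-ip₃-ip₂ v1 v0)
  ∷ᵃ complete-by (>ˡ-by-ip₂-≡ʰ v0 (≡ʰ-by-ip₄ v1) ∧ᵇ <ʰ-by-<ʰ (<ʰ-by-ip₄ v1))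
  ∷ᵃ complete-by (>ˡ-by-ip₂-ii₁₄ v0 v1 ∧ᵇ <ʰ-by-ip₂-ii₁₄ v0 v1)
  ∷ᵃ complete-by (>ˡ-by-ip₂-ii₀₃ v0 v1 ∧ᵇ <ʰ-by-ip₂-ii₀₃ v0 v1)
  ∷ᵃ complete-by (ii₀₄-by-ip₂-ii₄₄-< v0 v1 v2)
  ∷ᵃ complete-by (ii₀₄-by-≡ʰ-ii₁₄ (≡ʰ-by-ip₃ v0) v1)
  ∷ᵃ complete-by (ii₀₄-by-≡ʰ-ii₁₄ (≡ʰ-by-ip₄ v0) v1)
  ∷ᵃ complete-by (ii₀₄-by-ii₁₄-ii₂₄ v0 v1)
  ∷ᵃ complete-by (ii₀₄-by-ii₁₄-ii₀₃ v0 v1)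
  ∷ᵃ complete-by (ii₀₄-by-ii₁₄-ii₄₄ v0 v1)
  ∷ᵃ complete-by (ii₀₄-by-ii₂₄-ii₀₃ v0 v1)
  ∷ᵃ complete-by (ii₀₄-by-ii₀₃-ii₄₄ v0 v1)
  ∷ᵃ complete-by (ii₀₄-by-ii₃₄ v0)
  ∷ᵃ []ᵃ
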